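{- For every $n\ge1$, the number of $2$-row-restricted slicings of size $n$ equals the number of $0$-skinny slicings of size $n$.
   Context: Parallelogram polyominoes are edge-connected sets of unit cells bounded by two lattice paths with steps $(0,1)$ and $(1,0)$ meeting only at their endpoints. The size is $k+\ell-1$ for a $k\times\ell$ bounding rectangle. A Baxter slicing of size $n$ is such a polyomino $P$ of size $n$ divided into $n$ blocks, defined recursively: - for $n=1$, the single cell is the single block; - for $n\ge2$, one block is the topmost row (horizontal block) or the rightmost column (vertical block), and the other blocks form a Baxter slicing of the polyomino obtained by deleting it. A $2$-row-restricted slicing is a Baxter slicing all of whose horizontal blocks have width at most $2$. For a horizontal block $u$: - $\ell(u)$ is its width; - $X(u)$ is the lowest point of the lower border of $P$ with the abscissa of the right edge of $u$; - $r(u)$ is the number of horizontal steps of the lower border read leftwards from $X(u)$ before a vertical step or the bottom-left corner of $P$ is met. A $0$-skinny slicing is a Baxter slicing with $\ell(u)\le r(u)$ for every horizontal block $u$. -}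

module Defs where

open import Data.Nat using (ℕ; zero; suc; _≤_; _∸_; _≟_)
open import Data.Product using (_×_; _,_; proj₁; proj₂; Σ)
open import Data.List using (List; []; _∷_; _++_; length; reverse; take; filter)
open import Data.List.Relation.Unary.All using (All)
open import Relation.Nullary using (yes; no)

-- A parallelogram polyomino is encoded by its list of columns, from left to
-- right; column i is the pair (bottom , top) of ordinates, so it consists of
-- the cells [i,i+1] × [j,j+1] with bottom ≤ j < top.  The bottom-left corner
-- of the polyomino is the origin.  (Only polyominoes produced by the
-- constructors of Slicing below ever occur; these are exactly the
-- parallelogram polyominoes with bottom-left corner at the origin.)
Column : Set
Column = ℕ × ℕ

Cols : Set
Cols = List Column

lastCol : Cols → Column
lastCol []           = (0 , 0)
lastCol (c ∷ [])     = c
lastCol (c ∷ d ∷ cs) = lastCol (d ∷ cs)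

-- height ℓ of the bounding rectangle (= ordinate of the top border)
height : Cols → ℕ
height P = proj₂ (lastCol P)

topWidth : Cols → ℕ
topWidth P = length (filter (λ c → proj₂ c ≟ height P) P)

lastHeight : Cols → ℕ
lastHeight P = height P ∸ proj₁ (lastCol P)

bump : ℕ → Cols → Cols
bump zero    cs             = cs
bump (suc w) []             = []
bump (suc w) ((b , t) ∷ cs) = (b , suc t) ∷ bump w cs

-- put a new topmost row of width w on P (it ends at the right border)
addRow : ℕ → Cols → Cols
addRow w P = reverse (bump w (reverse P))

-- put a new rightmost column of height h on P (it ends at the top border)
addCol : ℕ → Cols → Cols
addCol h P = P ++ ((height P ∸ h , height P) ∷ [])

-- Baxter slicings, following the recursive definition: a slicing of size
-- n+1 of the polyomino P' is a slicing of size n of a polyomino P together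
-- with a horizontal block (new topmost row of P', width w) or a vertical
-- block (new rightmost column of P', height h), such that deleting the block
-- from P' gives back P.  The size index equals the number of blocks, which
-- equals k + ℓ - 1 for the k × ℓ bounding rectangle.
data Slicing : ℕ → Cols → Set where
  single : Slicing 1 ((0 , 1) ∷ [])
  hor    : ∀ {n P} → Slicing n P → (w : ℕ) → 1 ≤ w → w ≤ topWidth P →
           Slicing (suc n) (addRow w P)
  ver    : ∀ {n P} → Slicing n P → (h : ℕ) → 1 ≤ h → h ≤ lastHeight P →
           Slicing (suc n) (addCol h P)

-- The horizontal blocks u of a slicing, each recorded as the pair
-- (ℓ(u) , abscissa of the right edge of u).  (The unique block of the size-1
-- slicing is not recorded; it satisfies both restrictions whatever its kind.)
hblocks : ∀ {n P} → Slicing n P → List (ℕ × ℕ)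
hblocks single                 = []
hblocks (hor {P = P} s w _ _)  = (w , length P) ∷ hblocks s
hblocks (ver s h _ _)          = hblocks s

leftRun : ℕ → Cols → ℕ
leftRun b []             = 0
leftRun b ((b' , t) ∷ cs) with b' ≟ b
... | yes _ = suc (leftRun b cs)
... | no  _ = 0

-- r(x) for the polyomino Q: X is the lowest point of the lower border with
-- abscissa x, i.e. (x , bottom of column x-1); reading the lower border
-- leftwards from X, one meets one horizontal step per column (going left)
-- as long as the bottom stays the same, and stops at a vertical step or at
-- the bottom-left corner.
rAt : Cols → ℕ → ℕ
rAt Q x = leftRun (proj₁ (lastCol (take x Q))) (reverse (take x Q))

TwoRowRestricted : ∀ {n P} → Slicing n P → Set
TwoRowRestricted s = All (λ u → proj₁ u ≤ 2) (hblocks s)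

ZeroSkinny : ∀ {n P} → Slicing n P → Set
ZeroSkinny {P = P} s = All (λ u → proj₁ u ≤ rAt P (proj₂ u)) (hblocks s)

SlicingsWith : ℕ → (∀ {n P} → Slicing n P → Set) → Set
SlicingsWith n Q = Σ Cols (λ P → Σ (Slicing n P) (λ s → Q s))

-- Removing the last block of a slicing (its topmost row or rightmost column) leaves a slicing
-- of size one less, so both classes are generating trees.  Label a slicing by (m , b), where b is
-- the height of its rightmost column and m the number of admissible widths of a new topmost row:
-- min(topWidth, 2) for 2-row-restricted slicings, min(topWidth, r at the right border) for 0-skinny
-- ones.  The labels of the extensions depend only on (m , b):
--   2-row-restricted:  (m , b) ↦ (i , b + 1) for 1 ≤ i ≤ m,  (2 , j) for 1 ≤ j ≤ b;
--   0-skinny:          (m , b) ↦ (i , b + 1) for 1 ≤ i ≤ m,  (1 , j) for 1 ≤ j < b,  (m + 1 , b),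
-- both trees starting at (1 , 1).  By induction on the depth, the skinny counts at (m , 1) and
-- (m , 2) equal the restricted counts at (1 , m) and (2 , m); the step uses the recurrence
-- S(m , b + 2) + S(m , b) = S(m , b + 1) + S(m + 1 , b) of the skinny counts.

module Submission where

open import Defs
open import Data.Nat using (ℕ; zero; suc; _+_; _∸_; _≤_; _<_; _≟_; _⊓_; z≤n; s≤s; s≤s⁻¹)
open import Data.Nat.Properties
open import Data.Nat.Tactic.RingSolver using (solve-∀)
open import Data.Fin using (Fin; zero; suc; toℕ; fromℕ<)
open import Data.Fin.Properties using (+↔⊎; 1↔⊤; toℕ-inject₁; toℕ-fromℕ; toℕ<n; toℕ-fromℕ<; fromℕ<-toℕ)
open import Data.Product using (Σ; _×_; _,_; proj₁; proj₂; uncurry)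
open import Data.Product.Algebra using (Σ-assoc)
open import Data.Product.Function.Dependent.Propositional using (Σ-↔)
open import Data.Sum using (_⊎_; inj₁; inj₂)
open import Data.Sum.Algebra using (⊎-cong)
open import Data.Unit using (⊤; tt)
open import Data.List using (List; []; _∷_; _++_; length; reverse; take; filter; map)
open import Data.List.Properties
  using (reverse-map; take-map; reverse-involutive; reverse-++; unfold-reverse; take-all;
         length-map; length-++; ∷-injective; filter-accept; filter-none)
open import Data.List.Relation.Unary.All as All using (All; []; _∷_)
open import Data.List.Relation.Binary.Permutation.Propositional using (↭-sym)
open import Data.List.Relation.Binary.Permutation.Propositional.Properties
  using (↭-length; filter-↭; ↭-reverse)
open import Function using (_∘_; id)
open import Function.Bundles using (_↔_; _⇔_; Inverse; Equivalence; mk↔ₛ′; mk⇔)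
open import Function.Properties.Inverse using (↔-refl; ↔-sym; ↔-trans)
open import Function.Related.TypeIsomorphisms using (Σ-distribʳ-⊎)
open import Relation.Binary.PropositionalEquality
open import Relation.Nullary using (Dec; yes; no; contradiction)
open import Algebra.Properties.CommutativeMonoid.Sum +-0-commutativeMonoid
  using (sum-syntax; sum-cong-≗; ∑-distrib-+; sum-init-last)

Σ-Fin-suc↔ : ∀ {m} {B : Fin (suc m) → Set} → Σ (Fin (suc m)) B ↔ (B zero ⊎ Σ (Fin m) (B ∘ suc))
Σ-Fin-suc↔ = mk↔ₛ′
  (λ { (zero , b) → inj₁ b ; (suc i , b) → inj₂ (i , b) })
  (λ { (inj₁ b) → zero , b ; (inj₂ (i , b)) → suc i , b })
  (λ { (inj₁ _) → refl ; (inj₂ _) → refl })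
  (λ { (zero , _) → refl ; (suc _ , _) → refl })

Σ-Fin↔Fin-∑ : ∀ m {B : Fin m → Set} (f : Fin m → ℕ) →
              (∀ i → B i ↔ Fin (f i)) → Σ (Fin m) B ↔ Fin (∑[ i < m ] f i)
Σ-Fin↔Fin-∑ zero    f B↔ = mk↔ₛ′ (λ ()) (λ ()) (λ ()) (λ ())
Σ-Fin↔Fin-∑ (suc m) f B↔ =
  ↔-trans Σ-Fin-suc↔ (↔-trans (⊎-cong (B↔ zero) (Σ-Fin↔Fin-∑ m (f ∘ suc) (B↔ ∘ suc))) (↔-sym +↔⊎))

∑-last : ∀ m (f : ℕ → ℕ) → ∑[ i < suc m ] f (toℕ i) ≡ ∑[ i < m ] f (toℕ i) + f m
∑-last m f = trans (sum-init-last {m} (f ∘ toℕ))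
                   (cong₂ _+_ (sum-cong-≗ {m} (cong f ∘ toℕ-inject₁)) (cong f (toℕ-fromℕ m)))

∑-telescope : ∀ m (a b g : ℕ → ℕ) → (∀ i → a i + g i ≡ b i + g (suc i)) →
              ∑[ i < m ] a (toℕ i) + g 0 ≡ ∑[ i < m ] b (toℕ i) + g m
∑-telescope zero    a b g step = refl
∑-telescope (suc m) a b g step = begin
  a 0 + A + g 0          ≡⟨ shuffle (a 0) A (g 0) ⟩
  (a 0 + g 0) + A        ≡⟨ cong (_+ A) (step 0) ⟩
  (b 0 + g 1) + A        ≡⟨ shuffle′ (b 0) (g 1) A ⟩
  b 0 + (A + g 1)        ≡⟨ cong (b 0 +_) (∑-telescope m (a ∘ suc) (b ∘ suc) (g ∘ suc) (step ∘ suc)) ⟩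
  b 0 + (B + g (suc m))  ≡⟨ +-assoc (b 0) B (g (suc m)) ⟨
  b 0 + B + g (suc m)    ∎
  where
  open ≡-Reasoning
  A = ∑[ i < m ] a (suc (toℕ i))
  B = ∑[ i < m ] b (suc (toℕ i))
  shuffle : ∀ x y z → x + y + z ≡ (x + z) + y
  shuffle = solve-∀
  shuffle′ : ∀ x y z → (x + y) + z ≡ x + (z + y)
  shuffle′ = solve-∀

-- Generating trees

module GeneratingTree {L : Set} (Child : L → Set) (child : ∀ {l} → Child l → L) where

  Path : ℕ → L → Set
  Path zero    _ = ⊤
  Path (suc k) l = Σ (Child l) (λ c → Path k (child c))

  Path-cong : ∀ k {l l′} → l ≡ l′ → Path k l ↔ Path k l′
  Path-cong k refl = ↔-refl

  module Class (C : ℕ → Set) (label : ∀ {n} → C n → L)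
               (grow : ∀ {n} → C (suc n) ↔ Σ (C n) (Child ∘ label))
               (label-grow : ∀ {n} (x : C (suc n)) → label x ≡ child (proj₂ (Inverse.to grow x)))
               where

    C[k+n]↔ΣPath : ∀ k n → C (k + n) ↔ Σ (C n) (Path k ∘ label)
    C[k+n]↔ΣPath zero    n = mk↔ₛ′ (_, tt) proj₁ (λ _ → refl) (λ _ → refl)
    C[k+n]↔ΣPath (suc k) n = subst (λ i → C i ↔ Σ (C n) (Path (suc k) ∘ label)) (+-suc k n)
      (↔-trans (C[k+n]↔ΣPath k (suc n))
      (↔-trans (Σ-↔ {B = λ (x , c) → Path k (child c)} grow (λ {x} → Path-cong k (label-grow x)))
               Σ-assoc))

    class↔Path : (C 0 ↔ ⊤) → ∀ {root} → (∀ x → label x ≡ root) → ∀ k → C k ↔ Path k root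
    class↔Path C₀↔⊤ label-root k = subst (λ i → C i ↔ Path k _) (+-identityʳ k)
      (↔-trans (C[k+n]↔ΣPath k 0)
      (↔-trans (Σ-↔ C₀↔⊤ (λ {x} → Path-cong k (label-root x)))
               (mk↔ₛ′ proj₂ (tt ,_) (λ _ → refl) (λ _ → refl))))

Lab : Set
Lab = ℕ × ℕ

Block : Lab → Set
Block (m , b) = Fin m ⊎ Fin b

module BlockRule (vwidth : ℕ → ℕ → ℕ → ℕ) where

  -- inj₁ i is a new topmost row of width i + 1, inj₂ j a new rightmost column of height j + 1.
  child : ∀ {l} → Block l → Lab
  child {m , b} (inj₁ i) = suc (toℕ i) , suc b
  child {m , b} (inj₂ j) = vwidth m b (toℕ j) , suc (toℕ j)

  open GeneratingTree Block child public

  count : ℕ → Lab → ℕ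
  count zero    _       = 1
  count (suc k) (m , b) = ∑[ i < m ] count k (suc (toℕ i) , suc b)
                        + ∑[ j < b ] count k (vwidth m b (toℕ j) , suc (toℕ j))

  Path↔Fin-count : ∀ k l → Path k l ↔ Fin (count k l)
  Path↔Fin-count zero    l       = ↔-sym 1↔⊤
  Path↔Fin-count (suc k) (m , b) =
    ↔-trans Σ-distribʳ-⊎
    (↔-trans (⊎-cong (Σ-Fin↔Fin-∑ m _ (λ i → Path↔Fin-count k _))
                     (Σ-Fin↔Fin-∑ b _ (λ j → Path↔Fin-count k _)))
             (↔-sym +↔⊎))

-- The two succession rules and their counts

-- A column of height t + 1 is of full height iff t + 1 = b; only then does the bottom run of
-- the lower border continue.
skinnyWidth : ℕ → ℕ → ℕ → ℕ
skinnyWidth m b t with suc t ≟ b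
... | yes _ = suc m
... | no  _ = 1

skinnyWidth-≡ : ∀ m {b t} → suc t ≡ b → skinnyWidth m b t ≡ suc m
skinnyWidth-≡ m {b} {t} e with suc t ≟ b
... | yes _ = refl
... | no ne = contradiction e ne

skinnyWidth-≢ : ∀ m {b t} → suc t ≢ b → skinnyWidth m b t ≡ 1
skinnyWidth-≢ m {b} {t} ne with suc t ≟ b
... | yes e = contradiction e ne
... | no _  = refl

restrictedWidth : ℕ → ℕ → ℕ → ℕ
restrictedWidth _ _ _ = 2

module SkinnyRule = BlockRule skinnyWidth
module RestrictedRule = BlockRule restrictedWidth

open SkinnyRule using () renaming (count to countS)
open RestrictedRule using () renaming (count to countR)

countS-suc : ∀ n m c → countS (suc n) (m , suc c)
           ≡ ∑[ i < m ] countS n (suc (toℕ i) , suc (suc c))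
             + (∑[ j < c ] countS n (1 , suc (toℕ j)) + countS n (suc m , suc c))
countS-suc n m c = cong (∑[ i < m ] countS n (suc (toℕ i) , suc (suc c)) +_) (begin
  ∑[ j < suc c ] f (toℕ j)                                         ≡⟨ ∑-last c f ⟩
  ∑[ j < c ] f (toℕ j) + f c                                       ≡⟨ cong₂ _+_ (sum-cong-≗ short) full ⟩
  ∑[ j < c ] countS n (1 , suc (toℕ j)) + countS n (suc m , suc c) ∎)
  where
  open ≡-Reasoning
  f : ℕ → ℕ
  f t = countS n (skinnyWidth m (suc c) t , suc t)
  short : ∀ j → f (toℕ j) ≡ countS n (1 , suc (toℕ j))
  short j = cong (λ w → countS n (w , suc (toℕ j))) (skinnyWidth-≢ m (<⇒≢ (toℕ<n j) ∘ suc-injective))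
  full : f c ≡ countS n (suc m , suc c)
  full = cong (λ w → countS n (w , suc c)) (skinnyWidth-≡ m refl)

countS-recurrence : ∀ n m c → countS n (m , 3 + c) + countS n (m , 1 + c)
                            ≡ countS n (m , 2 + c) + countS n (suc m , 1 + c)
countS-recurrence zero    m c = refl
countS-recurrence (suc n) m c = begin
  countS (suc n) (m , 3 + c) + countS (suc n) (m , 1 + c)
    ≡⟨ cong₂ _+_ (countS-suc n m (2 + c)) (countS-suc n m c) ⟩
  (H (2 + c) + (V (2 + c) + x (suc m) (3 + c))) + (H c + (V c + x (suc m) (1 + c)))
    ≡⟨ interchange (H (2 + c)) (V (2 + c)) (x (suc m) (3 + c)) (H c) (V c) (x (suc m) (1 + c)) ⟩
  (H (2 + c) + H c) + ((V (2 + c) + V c) + (x (suc m) (3 + c) + x (suc m) (1 + c)))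
    ≡⟨ cong₂ _+_ horizontal (cong₂ _+_ (cong (_+ V c) (∑-last (suc c) (λ t → x 1 (suc t))))
                                       (countS-recurrence n (suc m) c)) ⟩
  (H (1 + c) + T) + ((V (1 + c) + x 1 (2 + c) + V c) + (x (suc m) (2 + c) + x (2 + m) (1 + c)))
    ≡⟨ regroup (H (1 + c)) T (V (1 + c)) (x 1 (2 + c)) (V c) (x (suc m) (2 + c)) (x (2 + m) (1 + c)) ⟩
  (H (1 + c) + (V (1 + c) + x (suc m) (2 + c))) + ((x 1 (2 + c) + T) + (V c + x (2 + m) (1 + c)))
    ≡⟨ cong₂ _+_ (countS-suc n m (1 + c)) (countS-suc n (suc m) c) ⟨
  countS (suc n) (m , 2 + c) + countS (suc n) (suc m , 1 + c) ∎
  where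
  open ≡-Reasoning
  x : ℕ → ℕ → ℕ
  x m b = countS n (m , b)
  H V : ℕ → ℕ
  H c = ∑[ i < m ] x (suc (toℕ i)) (2 + c)
  V c = ∑[ j < c ] x 1 (suc (toℕ j))
  T = ∑[ i < m ] x (2 + toℕ i) (2 + c)
  horizontal : H (2 + c) + H c ≡ H (1 + c) + T
  horizontal = begin
    H (2 + c) + H c
      ≡⟨ ∑-distrib-+ {m} _ _ ⟨
    ∑[ i < m ] (x (suc (toℕ i)) (4 + c) + x (suc (toℕ i)) (2 + c))
      ≡⟨ sum-cong-≗ {m} (λ i → countS-recurrence n (suc (toℕ i)) (suc c)) ⟩
    ∑[ i < m ] (x (suc (toℕ i)) (3 + c) + x (2 + toℕ i) (2 + c))
      ≡⟨ ∑-distrib-+ {m} _ _ ⟩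
    H (1 + c) + T ∎
  interchange : ∀ a b c d e f → (a + (b + c)) + (d + (e + f)) ≡ (a + d) + ((b + e) + (c + f))
  interchange = solve-∀
  regroup : ∀ a t v y w p q → (a + t) + ((v + y + w) + (p + q)) ≡ (a + (v + p)) + ((y + t) + (w + q))
  regroup = solve-∀

countS≡countR : ∀ n m → countS n (m , 1) ≡ countR n (1 , m) × countS n (m , 2) ≡ countR n (2 , m)
countS≡countR zero    m = refl , refl
countS≡countR (suc n) m = height-one , height-two
  where
  open ≡-Reasoning
  ih = countS≡countR n
  R₂ = ∑[ j < m ] countR n (2 , suc (toℕ j))
  S₂ = ∑[ i < m ] countS n (suc (toℕ i) , 2)
  S₂≡R₂ : S₂ ≡ R₂
  S₂≡R₂ = sum-cong-≗ {m} (λ i → proj₂ (ih (suc (toℕ i))))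
  height-one : countS (suc n) (m , 1) ≡ countR (suc n) (1 , m)
  height-one = begin
    countS (suc n) (m , 1)           ≡⟨ countS-suc n m 0 ⟩
    S₂ + countS n (suc m , 1)        ≡⟨ cong₂ _+_ S₂≡R₂ (proj₁ (ih (suc m))) ⟩
    R₂ + countR n (1 , suc m)        ≡⟨ +-comm R₂ _ ⟩
    countR n (1 , suc m) + R₂        ≡⟨ cong (_+ R₂) (+-identityʳ _) ⟨
    countR (suc n) (1 , m)           ∎
  telescoped : ∑[ i < m ] countS n (suc (toℕ i) , 3) + countS n (1 , 1) ≡ S₂ + countS n (suc m , 1)
  telescoped = ∑-telescope m (λ i → countS n (suc i , 3)) (λ i → countS n (suc i , 2))
                             (λ i → countS n (suc i , 1)) (λ i → countS-recurrence n (suc i) 0)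
  height-two : countS (suc n) (m , 2) ≡ countR (suc n) (2 , m)
  height-two = begin
    countS (suc n) (m , 2)
      ≡⟨ countS-suc n m 1 ⟩
    S₃ + ((countS n (1 , 1) + 0) + countS n (suc m , 2))
      ≡⟨ cong (λ y → S₃ + (y + countS n (suc m , 2))) (+-identityʳ _) ⟩
    S₃ + (countS n (1 , 1) + countS n (suc m , 2))
      ≡⟨ +-assoc S₃ _ _ ⟨
    (S₃ + countS n (1 , 1)) + countS n (suc m , 2)
      ≡⟨ cong (_+ countS n (suc m , 2)) telescoped ⟩
    (S₂ + countS n (suc m , 1)) + countS n (suc m , 2)
      ≡⟨ cong₂ _+_ (cong₂ _+_ S₂≡R₂ (proj₁ (ih (suc m)))) (proj₂ (ih (suc m))) ⟩
    (R₂ + countR n (1 , suc m)) + countR n (2 , suc m)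
      ≡⟨ rotate R₂ _ _ ⟩
    countR (suc n) (2 , m) ∎
    where
    S₃ = ∑[ i < m ] countS n (suc (toℕ i) , 3)
    rotate : ∀ a b c → (a + b) + c ≡ (b + (c + 0)) + a
    rotate = solve-∀

-- The polyomino of a slicing

bottoms : Cols → List ℕ
bottoms = map proj₁

leftRun-bottoms : ∀ b {cs cs′} → bottoms cs ≡ bottoms cs′ → leftRun b cs ≡ leftRun b cs′
leftRun-bottoms b {[]}            {[]}              _ = refl
leftRun-bottoms b {(b₁ , _) ∷ cs} {(b₁′ , _) ∷ cs′} e with ∷-injective e
... | refl , e′ with b₁ ≟ b
...   | yes _ = cong suc (leftRun-bottoms b e′)
...   | no  _ = refl

lastCol-bottoms : ∀ {cs cs′} → bottoms cs ≡ bottoms cs′ → proj₁ (lastCol cs) ≡ proj₁ (lastCol cs′)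
lastCol-bottoms {[]}         {[]}           _ = refl
lastCol-bottoms {_ ∷ []}     {_ ∷ []}       e = proj₁ (∷-injective e)
lastCol-bottoms {_ ∷ d ∷ cs} {_ ∷ d′ ∷ cs′} e =
  lastCol-bottoms {d ∷ cs} {d′ ∷ cs′} (proj₂ (∷-injective e))

rAt-bottoms : ∀ {Q Q′} → bottoms Q ≡ bottoms Q′ → ∀ x → rAt Q x ≡ rAt Q′ x
rAt-bottoms {Q} {Q′} e x =
  trans (cong (λ b → leftRun b (reverse (take x Q))) (lastCol-bottoms prefix))
        (leftRun-bottoms _ (trans (reverse-map proj₁ (take x Q))
                           (trans (cong reverse prefix) (sym (reverse-map proj₁ (take x Q′))))))
  where
  prefix : bottoms (take x Q) ≡ bottoms (take x Q′)
  prefix = trans (sym (take-map x Q)) (trans (cong (take x) e) (take-map x Q′))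

bottoms-bump : ∀ w cs → bottoms (bump w cs) ≡ bottoms cs
bottoms-bump zero    cs             = refl
bottoms-bump (suc w) []             = refl
bottoms-bump (suc w) ((b , _) ∷ cs) = cong (b ∷_) (bottoms-bump w cs)

bottoms-addRow : ∀ w P → bottoms (addRow w P) ≡ bottoms P
bottoms-addRow w P = begin
  bottoms (reverse (bump w (reverse P))) ≡⟨ reverse-map proj₁ (bump w (reverse P)) ⟩
  reverse (bottoms (bump w (reverse P))) ≡⟨ cong reverse (bottoms-bump w (reverse P)) ⟩
  reverse (bottoms (reverse P))          ≡⟨ cong reverse (reverse-map proj₁ P) ⟩
  reverse (reverse (bottoms P))          ≡⟨ reverse-involutive (bottoms P) ⟩
  bottoms P                              ∎
  where open ≡-Reasoning

rAt-addRow : ∀ w P x → rAt (addRow w P) x ≡ rAt P x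
rAt-addRow w P = rAt-bottoms (bottoms-addRow w P)

length-addRow : ∀ w P → length (addRow w P) ≡ length P
length-addRow w P = trans (sym (length-map proj₁ (addRow w P)))
                          (trans (cong length (bottoms-addRow w P)) (length-map proj₁ P))

take-++ˡ : ∀ x (xs ys : Cols) → x ≤ length xs → take x (xs ++ ys) ≡ take x xs
take-++ˡ zero    xs       ys _         = refl
take-++ˡ (suc x) (c ∷ xs) ys (s≤s x≤) = cong (c ∷_) (take-++ˡ x xs ys x≤)

rAt-addCol : ∀ h P {x} → x ≤ length P → rAt (addCol h P) x ≡ rAt P x
rAt-addCol h P {x} x≤ = cong (λ T → leftRun (proj₁ (lastCol T)) (reverse T)) (take-++ˡ x P _ x≤)

length-addCol : ∀ h P → length (addCol h P) ≡ suc (length P)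
length-addCol h P = trans (length-++ P) (+-comm (length P) 1)

hblocks-positions : ∀ {n P} (s : Slicing n P) → All (λ u → proj₂ u ≤ length P) (hblocks s)
hblocks-positions single = []
hblocks-positions (hor {P = P} s w _ _) =
  subst (λ L → All (λ u → proj₂ u ≤ L) ((w , length P) ∷ hblocks s)) (sym (length-addRow w P))
        (≤-refl ∷ hblocks-positions s)
hblocks-positions (ver {P = P} s h _ _) =
  subst (λ L → All (λ u → proj₂ u ≤ L) (hblocks s)) (sym (length-addCol h P))
        (All.map m≤n⇒m≤1+n (hblocks-positions s))

data TopShape (H : ℕ) : ℕ → Cols → Set where
  below : ∀ {cs} → All (λ c → proj₂ c < H) cs → TopShape H 0 cs
  atTop : ∀ {k b cs} → TopShape H k cs → TopShape H (suc k) ((b , H) ∷ cs)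

TopShape-count : ∀ {H k cs} → TopShape H k cs → length (filter (λ c → proj₂ c ≟ H) cs) ≡ k
TopShape-count {H} (below lows) = cong length (filter-none (λ c → proj₂ c ≟ H) (All.map <⇒≢ lows))
TopShape-count {H} (atTop ts)   =
  trans (cong length (filter-accept (λ c → proj₂ c ≟ H) refl)) (cong suc (TopShape-count ts))

TopShape-≤ : ∀ {H k cs} → TopShape H k cs → All (λ c → proj₂ c ≤ H) cs
TopShape-≤ (below lows) = All.map <⇒≤ lows
TopShape-≤ (atTop ts)   = ≤-refl ∷ TopShape-≤ ts

TopShape-bump : ∀ {H k cs} w → w ≤ k → TopShape H k cs → TopShape (suc H) w (bump w cs)
TopShape-bump zero    _        ts         = below (All.map s≤s (TopShape-≤ ts))
TopShape-bump (suc w) (s≤s w≤) (atTop ts) = atTop (TopShape-bump w w≤ ts)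

lastCol-∷ʳ : ∀ cs c → lastCol (cs ++ c ∷ []) ≡ c
lastCol-∷ʳ []           c = refl
lastCol-∷ʳ (_ ∷ [])     c = refl
lastCol-∷ʳ (_ ∷ d ∷ cs) c = lastCol-∷ʳ (d ∷ cs) c

lastCol-reverse : ∀ {P c cs} → reverse P ≡ c ∷ cs → lastCol P ≡ c
lastCol-reverse {P} {c} {cs} e = begin
  lastCol P                        ≡⟨ cong lastCol (reverse-involutive P) ⟨
  lastCol (reverse (reverse P))    ≡⟨ cong (lastCol ∘ reverse) e ⟩
  lastCol (reverse (c ∷ cs))       ≡⟨ cong lastCol (unfold-reverse c cs) ⟩
  lastCol (reverse cs ++ c ∷ [])   ≡⟨ lastCol-∷ʳ (reverse cs) c ⟩
  c                                ∎
  where open ≡-Reasoning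

leftRun-here : ∀ b t cs → leftRun b ((b , t) ∷ cs) ≡ suc (leftRun b cs)
leftRun-here b t cs with b ≟ b
... | yes _ = refl
... | no ne = contradiction refl ne

leftRun-stop : ∀ {b b′} t cs → b′ ≢ b → leftRun b ((b′ , t) ∷ cs) ≡ 0
leftRun-stop {b} {b′} t cs ne with b′ ≟ b
... | yes e = contradiction e ne
... | no _  = refl

-- r at the right border of P: a new topmost row of a 0-skinny slicing is at most this wide.
rRight : Cols → ℕ
rRight P = rAt P (length P)

-- The columns of P read from the right: first (bottom , top), then the others, of which the
-- first `width` ones reach the top as well.
record Shape (P : Cols) : Set where
  field
    bottom top width : ℕ
    others           : Cols
    reverse≡         : reverse P ≡ (bottom , top) ∷ others
    bottom≤top       : bottom ≤ top
    othersShape      : TopShape top width others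

  lastCol≡ : lastCol P ≡ (bottom , top)
  lastCol≡ = lastCol-reverse {P} reverse≡

  height≡ : height P ≡ top
  height≡ = cong proj₂ lastCol≡

  lastHeight≡ : lastHeight P ≡ top ∸ bottom
  lastHeight≡ = cong₂ _∸_ height≡ (cong proj₁ lastCol≡)

  topWidth≡ : topWidth P ≡ suc width
  topWidth≡ = begin
    length (filter (atHeight (height P)) P)
      ≡⟨ cong (λ H → length (filter (atHeight H) P)) height≡ ⟩
    length (filter (atHeight top) P)
      ≡⟨ ↭-length (filter-↭ (atHeight top) (↭-sym (↭-reverse P))) ⟩
    length (filter (atHeight top) (reverse P))
      ≡⟨ cong (length ∘ filter (atHeight top)) reverse≡ ⟩
    length (filter (atHeight top) ((bottom , top) ∷ others))
      ≡⟨ cong length (filter-accept (atHeight top) refl) ⟩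
    suc (length (filter (atHeight top) others))
      ≡⟨ cong suc (TopShape-count othersShape) ⟩
    suc width ∎
    where
    open ≡-Reasoning
    atHeight : ∀ H (c : Column) → Dec (proj₂ c ≡ H)
    atHeight H c = proj₂ c ≟ H

  rRight≡ : rRight P ≡ suc (leftRun bottom others)
  rRight≡ = begin
    rAt P (length P)
      ≡⟨ cong (λ T → leftRun (proj₁ (lastCol T)) (reverse T)) (take-all (length P) P ≤-refl) ⟩
    leftRun (proj₁ (lastCol P)) (reverse P)
      ≡⟨ cong₂ (λ c cs → leftRun (proj₁ c) cs) lastCol≡ reverse≡ ⟩
    leftRun bottom ((bottom , top) ∷ others)
      ≡⟨ leftRun-here bottom top others ⟩
    suc (leftRun bottom others) ∎
    where open ≡-Reasoning

shape-addRow : ∀ {P} → Shape P → ∀ w → 1 ≤ w → w ≤ topWidth P → Shape (addRow w P)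
shape-addRow {P} sh (suc w) _ w≤ = record
  { bottom      = bottom
  ; top         = suc top
  ; width       = w
  ; others      = bump w others
  ; reverse≡    = trans (reverse-involutive (bump (suc w) (reverse P)))
                        (cong (bump (suc w)) reverse≡)
  ; bottom≤top  = m≤n⇒m≤1+n bottom≤top
  ; othersShape = TopShape-bump w (s≤s⁻¹ (subst (suc w ≤_) topWidth≡ w≤)) othersShape
  }
  where open Shape sh

shape-addCol : ∀ {P} → Shape P → ∀ h → Shape (addCol h P)
shape-addCol {P} sh h = record
  { bottom      = top ∸ h
  ; top         = top
  ; width       = suc width
  ; others      = (bottom , top) ∷ others
  ; reverse≡    = trans (reverse-++ P _) (cong₂ (λ H cs → (H ∸ h , H) ∷ cs) height≡ reverse≡)
  ; bottom≤top  = m∸n≤m top h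
  ; othersShape = atTop othersShape
  }
  where open Shape sh

shape : ∀ {n P} → Slicing n P → Shape P
shape single            = record { bottom = 0 ; top = 1 ; width = 0 ; others = []
                                 ; reverse≡ = refl ; bottom≤top = z≤n ; othersShape = below [] }
shape (hor s w 1≤w w≤)  = shape-addRow (shape s) w 1≤w w≤
shape (ver s h _ _)     = shape-addCol (shape s) h

rRight-addRow : ∀ w P → rRight (addRow w P) ≡ rRight P
rRight-addRow w P = trans (cong (rAt (addRow w P)) (length-addRow w P)) (rAt-addRow w P (length P))

module _ {n P} (s : Slicing n P) where
  open Shape (shape s)

  topWidth-addRow : ∀ {w} → 1 ≤ w → w ≤ topWidth P → topWidth (addRow w P) ≡ w
  topWidth-addRow {suc w} 1≤w w≤ = Shape.topWidth≡ (shape-addRow (shape s) (suc w) 1≤w w≤)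

  lastHeight-addRow : ∀ {w} → 1 ≤ w → w ≤ topWidth P → lastHeight (addRow w P) ≡ suc (lastHeight P)
  lastHeight-addRow {suc w} 1≤w w≤ = begin
    lastHeight (addRow (suc w) P) ≡⟨ Shape.lastHeight≡ (shape-addRow (shape s) (suc w) 1≤w w≤) ⟩
    suc top ∸ bottom        ≡⟨ +-∸-assoc 1 bottom≤top ⟩
    suc (top ∸ bottom)      ≡⟨ cong suc lastHeight≡ ⟨
    suc (lastHeight P)      ∎
    where open ≡-Reasoning

  topWidth-addCol : ∀ h → topWidth (addCol h P) ≡ suc (topWidth P)
  topWidth-addCol h = trans (Shape.topWidth≡ (shape-addCol (shape s) h)) (cong suc (sym topWidth≡))

  1≤topWidth : 1 ≤ topWidth P
  1≤topWidth = subst (1 ≤_) (sym topWidth≡) (s≤s z≤n)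

  private
    h≤top : ∀ {h} → h ≤ lastHeight P → h ≤ top
    h≤top h≤ = ≤-trans h≤ (≤-trans (≤-reflexive lastHeight≡) (m∸n≤m top bottom))

  lastHeight-addCol : ∀ {h} → h ≤ lastHeight P → lastHeight (addCol h P) ≡ h
  lastHeight-addCol {h} h≤ = trans (Shape.lastHeight≡ (shape-addCol (shape s) h)) (m∸[m∸n]≡n (h≤top h≤))

  rRight-addCol-full : ∀ {h} → h ≡ lastHeight P → rRight (addCol h P) ≡ suc (rRight P)
  rRight-addCol-full {h} h≡ = begin
    rRight (addCol h P)
      ≡⟨ Shape.rRight≡ (shape-addCol (shape s) h) ⟩
    suc (leftRun (top ∸ h) ((bottom , top) ∷ others))
      ≡⟨ cong (λ b → suc (leftRun b ((bottom , top) ∷ others))) same-bottom ⟩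
    suc (leftRun bottom ((bottom , top) ∷ others))
      ≡⟨ cong suc (leftRun-here bottom top others) ⟩
    suc (suc (leftRun bottom others))
      ≡⟨ cong suc rRight≡ ⟨
    suc (rRight P) ∎
    where
    open ≡-Reasoning
    same-bottom : top ∸ h ≡ bottom
    same-bottom = trans (cong (top ∸_) (trans h≡ lastHeight≡)) (m∸[m∸n]≡n bottom≤top)

  rRight-addCol-short : ∀ {h} → h ≤ lastHeight P → h ≢ lastHeight P → rRight (addCol h P) ≡ 1
  rRight-addCol-short {h} h≤ h≢ =
    trans (Shape.rRight≡ (shape-addCol (shape s) h)) (cong suc (leftRun-stop top others new-bottom))
    where
    new-bottom : bottom ≢ top ∸ h
    new-bottom e = h≢ (begin
      h                  ≡⟨ m∸[m∸n]≡n (h≤top h≤) ⟨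
      top ∸ (top ∸ h)    ≡⟨ cong (top ∸_) e ⟨
      top ∸ bottom       ≡⟨ lastHeight≡ ⟨
      lastHeight P       ∎)
      where open ≡-Reasoning

-- Slicings as generating trees

module Growth
  (Q            : ∀ {n P} → Slicing n P → Set)
  (Q-irrelevant : ∀ {n P} (s : Slicing n P) (q q′ : Q s) → q ≡ q′)
  (Q-single     : Q single)
  (bound        : Cols → ℕ)
  (Q-hor        : ∀ {n P} (s : Slicing n P) w p q → Q (hor s w p q) ⇔ (w ≤ bound P × Q s))
  (Q-ver        : ∀ {n P} (s : Slicing n P) h p q → Q (ver s h p q) ⇔ Q s)
  (vwidth       : ℕ → ℕ → ℕ → ℕ)
  (width-hor    : ∀ {n P} (s : Slicing n P) {w} → 1 ≤ w → w ≤ topWidth P ⊓ bound P →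
                  topWidth (addRow w P) ⊓ bound (addRow w P) ≡ w)
  (width-ver    : ∀ {n P} (s : Slicing n P) {t} → suc t ≤ lastHeight P →
                  topWidth (addCol (suc t) P) ⊓ bound (addCol (suc t) P)
                    ≡ vwidth (topWidth P ⊓ bound P) (lastHeight P) t)
  where

  open BlockRule vwidth

  Grown : ℕ → Set
  Grown n = SlicingsWith (suc n) Q

  label : ∀ {n} → Grown n → Lab
  label (P , _) = topWidth P ⊓ bound P , lastHeight P

  removeLast : ∀ {n} → Grown (suc n) → Σ (Grown n) (Block ∘ label)
  removeLast (_ , hor s zero () _ , _)
  removeLast (_ , hor {P = P} s (suc w) p w≤ , q) =
    let w≤bound , q′ = Equivalence.to (Q-hor s _ p w≤) q
    in (P , s , q′) , inj₁ (fromℕ< (⊓-glb w≤ w≤bound))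
  removeLast (_ , ver s zero () _ , _)
  removeLast (_ , ver {P = P} s (suc h) p h≤ , q) =
    (P , s , Equivalence.to (Q-ver s _ p h≤) q) , inj₂ (fromℕ< h≤)

  addLast : ∀ {n} → Σ (Grown n) (Block ∘ label) → Grown (suc n)
  addLast ((P , s , q) , inj₁ i) =
    addRow (suc (toℕ i)) P , hor s _ (s≤s z≤n) (≤-trans (toℕ<n i) (m⊓n≤m _ _)) ,
    Equivalence.from (Q-hor s _ _ _) (≤-trans (toℕ<n i) (m⊓n≤n _ _) , q)
  addLast ((P , s , q) , inj₂ j) =
    addCol (suc (toℕ j)) P , ver s _ (s≤s z≤n) (toℕ<n j) , Equivalence.from (Q-ver s _ _ _) q

  removeLast-addLast : ∀ {n} (y : Σ (Grown n) (Block ∘ label)) → removeLast (addLast y) ≡ y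
  removeLast-addLast ((P , s , q) , inj₁ i) =
    cong₂ (λ q c → (P , s , q) , c) (Q-irrelevant s _ q) (cong inj₁ (fromℕ<-toℕ i _))
  removeLast-addLast ((P , s , q) , inj₂ j) =
    cong₂ (λ q c → (P , s , q) , c) (Q-irrelevant s _ q) (cong inj₂ (fromℕ<-toℕ j _))

  hor-≡ : ∀ {n P} (s : Slicing n P) {w w′} → w ≡ w′ →
          ∀ {p p′ q q′} (z : Q (hor s w p q)) (z′ : Q (hor s w′ p′ q′)) →
          _≡_ {A = Grown n} (addRow w P , hor s w p q , z) (addRow w′ P , hor s w′ p′ q′ , z′)
  hor-≡ s refl {p} {p′} {q} {q′} z z′ with ≤-irrelevant p p′ | ≤-irrelevant q q′
  ... | refl | refl = cong (λ z → _ , hor s _ p q , z) (Q-irrelevant (hor s _ p q) z z′)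

  ver-≡ : ∀ {n P} (s : Slicing n P) {h h′} → h ≡ h′ →
          ∀ {p p′ q q′} (z : Q (ver s h p q)) (z′ : Q (ver s h′ p′ q′)) →
          _≡_ {A = Grown n} (addCol h P , ver s h p q , z) (addCol h′ P , ver s h′ p′ q′ , z′)
  ver-≡ s refl {p} {p′} {q} {q′} z z′ with ≤-irrelevant p p′ | ≤-irrelevant q q′
  ... | refl | refl = cong (λ z → _ , ver s _ p q , z) (Q-irrelevant (ver s _ p q) z z′)

  addLast-removeLast : ∀ {n} (x : Grown (suc n)) → addLast (removeLast x) ≡ x
  addLast-removeLast (_ , hor s zero () _ , _)
  addLast-removeLast (_ , hor s (suc w) _ _ , q) = hor-≡ s (cong suc (toℕ-fromℕ< _)) _ q
  addLast-removeLast (_ , ver s zero () _ , _)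
  addLast-removeLast (_ , ver s (suc h) _ _ , q) = ver-≡ s (cong suc (toℕ-fromℕ< _)) _ q

  grow : ∀ {n} → Grown (suc n) ↔ Σ (Grown n) (Block ∘ label)
  grow = mk↔ₛ′ removeLast addLast removeLast-addLast addLast-removeLast

  label-grow : ∀ {n} (x : Grown (suc n)) → label x ≡ child (proj₂ (removeLast x))
  label-grow (_ , hor s zero () _ , _)
  label-grow (_ , hor s (suc w) 1≤w w≤ , q) = cong₂ _,_
    (trans (width-hor s 1≤w (⊓-glb w≤ (proj₁ (Equivalence.to (Q-hor s _ 1≤w w≤) q))))
           (cong suc (sym (toℕ-fromℕ< _))))
    (lastHeight-addRow s 1≤w w≤)
  label-grow (_ , ver s zero () _ , _)
  label-grow (_ , ver s (suc h) _ h≤ , q) = cong₂ _,_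
    (trans (width-ver s h≤) (cong (vwidth _ _) (sym (toℕ-fromℕ< h≤))))
    (trans (lastHeight-addCol s h≤) (cong suc (sym (toℕ-fromℕ< h≤))))

  Grown₀↔⊤ : Grown 0 ↔ ⊤
  Grown₀↔⊤ = mk↔ₛ′ (λ _ → tt) (λ _ → _ , single , Q-single) (λ _ → refl) single-unique
    where
    single-unique : ∀ x → (_ , single , Q-single) ≡ x
    single-unique (_ , single , q)       = cong (λ q → _ , single , q) (Q-irrelevant single Q-single q)
    single-unique (_ , hor () _ _ _ , _)
    single-unique (_ , ver () _ _ _ , _)

  root : Lab
  root = label {0} (_ , single , Q-single)

  label-root : ∀ (x : Grown 0) → label x ≡ root
  label-root (_ , single , _)       = refl
  label-root (_ , hor () _ _ _ , _)
  label-root (_ , ver () _ _ _ , _)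

  Grown↔Path : ∀ n → Grown n ↔ Path n root
  Grown↔Path = Class.class↔Path Grown label grow label-grow Grown₀↔⊤ label-root

restricted-irrelevant : ∀ {n P} (s : Slicing n P) (q q′ : TwoRowRestricted s) → q ≡ q′
restricted-irrelevant _ = All.irrelevant ≤-irrelevant

restricted-hor : ∀ {n P} (s : Slicing n P) w p q →
                 TwoRowRestricted (hor s w p q) ⇔ (w ≤ 2 × TwoRowRestricted s)
restricted-hor _ _ _ _ = mk⇔ All.uncons (uncurry _∷_)

restricted-ver : ∀ {n P} (s : Slicing n P) h p q → TwoRowRestricted (ver s h p q) ⇔ TwoRowRestricted s
restricted-ver _ _ _ _ = mk⇔ id id

restricted-width-hor : ∀ {n P} (s : Slicing n P) {w} → 1 ≤ w → w ≤ topWidth P ⊓ 2 →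
                       topWidth (addRow w P) ⊓ 2 ≡ w
restricted-width-hor s 1≤w w≤ = trans (cong (_⊓ 2) (topWidth-addRow s 1≤w (≤-trans w≤ (m⊓n≤m _ 2))))
                                      (m≤n⇒m⊓n≡m (≤-trans w≤ (m⊓n≤n _ 2)))

restricted-width-ver : ∀ {n P} (s : Slicing n P) {t} → suc t ≤ lastHeight P →
                       topWidth (addCol (suc t) P) ⊓ 2 ≡ 2
restricted-width-ver s {t} _ =
  trans (cong (_⊓ 2) (topWidth-addCol s (suc t))) (m≥n⇒m⊓n≡n (s≤s (1≤topWidth s)))

module Restricted = Growth TwoRowRestricted restricted-irrelevant [] (λ _ → 2)
  restricted-hor restricted-ver restrictedWidth restricted-width-hor restricted-width-ver

skinny-irrelevant : ∀ {n P} (s : Slicing n P) (q q′ : ZeroSkinny s) → q ≡ q′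
skinny-irrelevant _ = All.irrelevant ≤-irrelevant

skinny-resp : ∀ {Q Q′ us} → All (λ u → rAt Q (proj₂ u) ≡ rAt Q′ (proj₂ u)) us →
              All (λ u → proj₁ u ≤ rAt Q (proj₂ u)) us → All (λ u → proj₁ u ≤ rAt Q′ (proj₂ u)) us
skinny-resp agree zs = All.zipWith (λ (e , z) → subst (_ ≤_) e z) (agree , zs)

skinny-hor : ∀ {n P} (s : Slicing n P) w p q →
             ZeroSkinny (hor s w p q) ⇔ (w ≤ rRight P × ZeroSkinny s)
skinny-hor {P = P} s w _ _ = mk⇔
  (λ { (z ∷ zs) → subst (w ≤_) (rAt-addRow w P (length P)) z , skinny-resp agree zs })
  (λ (z , zs) → subst (w ≤_) (sym (rAt-addRow w P (length P))) z ∷ skinny-resp (All.map sym agree) zs)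
  where
  agree : All (λ u → rAt (addRow w P) (proj₂ u) ≡ rAt P (proj₂ u)) (hblocks s)
  agree = All.tabulate (λ {u} _ → rAt-addRow w P (proj₂ u))

skinny-ver : ∀ {n P} (s : Slicing n P) h p q → ZeroSkinny (ver s h p q) ⇔ ZeroSkinny s
skinny-ver {P = P} s h _ _ = mk⇔ (skinny-resp agree) (skinny-resp (All.map sym agree))
  where
  agree : All (λ u → rAt (addCol h P) (proj₂ u) ≡ rAt P (proj₂ u)) (hblocks s)
  agree = All.map (rAt-addCol h P) (hblocks-positions s)

skinny-width-hor : ∀ {n P} (s : Slicing n P) {w} → 1 ≤ w → w ≤ topWidth P ⊓ rRight P →
                   topWidth (addRow w P) ⊓ rRight (addRow w P) ≡ w
skinny-width-hor {P = P} s {w} 1≤w w≤ =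
  trans (cong₂ _⊓_ (topWidth-addRow s 1≤w (≤-trans w≤ (m⊓n≤m _ _))) (rRight-addRow w P))
        (m≤n⇒m⊓n≡m (≤-trans w≤ (m⊓n≤n _ _)))

skinny-width-ver : ∀ {n P} (s : Slicing n P) {t} → suc t ≤ lastHeight P →
                   topWidth (addCol (suc t) P) ⊓ rRight (addCol (suc t) P)
                     ≡ skinnyWidth (topWidth P ⊓ rRight P) (lastHeight P) t
skinny-width-ver {P = P} s {t} t< = by-cases (suc t ≟ lastHeight P)
  where
  by-cases : Dec (suc t ≡ lastHeight P) → topWidth (addCol (suc t) P) ⊓ rRight (addCol (suc t) P)
                                          ≡ skinnyWidth (topWidth P ⊓ rRight P) (lastHeight P) t
  by-cases (yes full)  = trans (cong₂ _⊓_ (topWidth-addCol s (suc t)) (rRight-addCol-full s full))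
                               (sym (skinnyWidth-≡ _ full))
  by-cases (no  short) = trans (cong₂ _⊓_ (topWidth-addCol s (suc t)) (rRight-addCol-short s t< short))
                               (trans (m≥n⇒m⊓n≡n (s≤s z≤n)) (sym (skinnyWidth-≢ _ short)))

module Skinny = Growth ZeroSkinny skinny-irrelevant [] rRight
  skinny-hor skinny-ver skinnyWidth skinny-width-hor skinny-width-ver

Path-restricted↔skinny : ∀ n → RestrictedRule.Path n (1 , 1) ↔ SkinnyRule.Path n (1 , 1)
Path-restricted↔skinny n =
  ↔-trans (RestrictedRule.Path↔Fin-count n (1 , 1))
  (↔-trans (subst (λ k → Fin (countR n (1 , 1)) ↔ Fin k) (sym (proj₁ (countS≡countR n 1))) ↔-refl)
           (↔-sym (SkinnyRule.Path↔Fin-count n (1 , 1))))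

theorem12 : (n : ℕ) → 1 ≤ n →
    SlicingsWith n TwoRowRestricted ↔ SlicingsWith n ZeroSkinny
theorem12 zero    ()
theorem12 (suc n) _ =
  ↔-trans (Restricted.Grown↔Path n) (↔-trans (Path-restricted↔skinny n) (↔-sym (Skinny.Grown↔Path n)))
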